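{- If $P$ is a polytope with $n$ vertices such that every facet of $P$ contains at most $k$ vertices, then $\mathrm{rc}(P) = O(k^2 \log n)$.
   Context: For a real matrix $M$, a rectangle is a set $I\times J$ with $I$ a set of row indices and $J$ a set of column indices; a rectangle covering of $M$ is a set of rectangles, each contained in $\mathrm{supp}(M)=\{(i,j): M_{i,j}\neq 0\}$, whose union is $\mathrm{supp}(M)$; $\mathrm{rc}(M)$ is the minimum size of a rectangle covering. For a polytope $P$ (neither empty nor a single point), $\mathrm{rc}(P)$ is $\mathrm{rc}(M)$ where $M$ is the facet vs.\ vertex non-incidence matrix of $P$: the 0/1-matrix with rows indexed by facets, columns by vertices, and entry $1$ iff the facet does not contain the vertex. Logarithms are base 2; the $O$ hides an absolute constant. -}

module Defs where

open import Level using (0ℓ)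
open import Data.Nat as ℕ using (ℕ; zero; suc)
open import Data.Fin using (Fin; zero; suc)
open import Data.Bool using (Bool; true; false)
open import Data.Vec using (Vec; lookup)
open import Data.Fin.Subset using (Subset; _∈_; _∉_; _⊆_; ∣_∣)
open import Data.Product using (Σ; ∃; _×_; _,_)
open import Data.List using (List)
open import Data.List.Membership.Propositional using () renaming (_∈_ to _∈L_)
open import Relation.Binary.PropositionalEquality using (_≡_; _≢_)
open import Relation.Binary.Structures using (IsTotalOrder)
open import Relation.Nullary using (¬_)
open import Algebra.Structures using (IsCommutativeRing)

-- Ordered fields (the stdlib has no reals and no fields).  The real
-- numbers are one instance; polytopes are taken over an arbitrary
-- ordered field K.

record OrderedField : Set₁ where
  field
    Carrier : Set
    _+_ _*_ : Carrier → Carrier → Carrier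
    -_      : Carrier → Carrier
    0# 1#   : Carrier
    _≤_     : Carrier → Carrier → Set
    isCommutativeRing : IsCommutativeRing _≡_ _+_ _*_ -_ 0# 1#
    0≢1     : 0# ≢ 1#
    inverse : ∀ x → x ≢ 0# → ∃ λ y → x * y ≡ 1#
    isTotalOrder : IsTotalOrder _≡_ _≤_
    +-mono  : ∀ {x y} z → x ≤ y → (x + z) ≤ (y + z)
    *-pos   : ∀ {x y} → 0# ≤ x → 0# ≤ y → 0# ≤ (x * y)

module Geometry (K : OrderedField) where
  open OrderedField K

  Σ[_] : ∀ {n} → (Fin n → Carrier) → Carrier
  Σ[_] {zero}  f = 0#
  Σ[_] {suc n} f = f zero + Σ[ (λ i → f (suc i)) ]

  Point : ℕ → Set
  Point d = Fin d → Carrier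

  _·_ : ∀ {d} → Point d → Point d → Carrier
  a · x = Σ[ (λ t → a t * x t) ]

  InConvexHullOfOthers : ∀ {d n} → (Fin n → Point d) → Fin n → Set
  InConvexHullOfOthers {d} {n} v i =
    Σ (Fin n → Carrier) λ λ' →
        (∀ j → 0# ≤ λ' j)
      × λ' i ≡ 0#
      × Σ[ λ' ] ≡ 1#
      × (∀ t → Σ[ (λ j → λ' j * v j t) ] ≡ v i t)

  -- v : Fin n → K^d lists the vertices of the polytope P = conv{v 0, …, v (n-1)}:
  -- no v i lies in the convex hull of the others (this forces distinctness)
  ConvexPosition : ∀ {d n} → (Fin n → Point d) → Set
  ConvexPosition v = ∀ i → ¬ InConvexHullOfOthers v i

  IsFace : ∀ {d n} → (Fin n → Point d) → Subset n → Set
  IsFace {d} {n} v F =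
    Σ (Point d) λ a → Σ Carrier λ b →
        (∀ j → (a · v j) ≤ b)
      × (∀ j → (j ∈ F → a · v j ≡ b) × (a · v j ≡ b → j ∈ F))

  IsProperFace : ∀ {d n} → (Fin n → Point d) → Subset n → Set
  IsProperFace {n = n} v F =
    IsFace v F × (∃ λ j → j ∈ F) × (∃ λ j → j ∉ F)

  -- facets = inclusion-maximal proper faces (identified with their vertex sets)
  IsFacet : ∀ {d n} → (Fin n → Point d) → Subset n → Set
  IsFacet v F = IsProperFace v F × (∀ G → IsProperFace v G → F ⊆ G → G ⊆ F)

  -- a rectangle I × J of the facet-vertex non-incidence matrix:
  -- I a set of rows (facets), J a set of columns (vertices)
  record Rectangle (n : ℕ) : Set₁ where
    constructor _×ᴿ_
    field
      rows : Subset n → Set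
      cols : Subset n

  InSupport : ∀ {d n} → (Fin n → Point d) → Rectangle n → Set
  InSupport v R = ∀ F → IsFacet v F → Rectangle.rows R F →
                  ∀ j → j ∈ Rectangle.cols R → j ∉ F

  IsRectangleCovering : ∀ {d n} → (Fin n → Point d) → List (Rectangle n) → Set₁
  IsRectangleCovering v Rs =
      (∀ {R} → R ∈L Rs → InSupport v R)
    × (∀ F → IsFacet v F → ∀ j → j ∉ F →
         ∃ λ R → R ∈L Rs × Rectangle.rows R F × j ∈ Rectangle.cols R)

module Submission where

-- Only the sizes of the facets matter.  A colouring h of
-- the vertices with 2k colours gives the rectangle whose columns are the vertices
-- of colour 0 and whose rows are the facets avoiding colour 0; it covers the entry
-- (F, j) whenever h isolates j from F, i.e. colours j but no vertex of F with 0.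
-- By a union bound each tuple (j, f₁, …, f_k) of vertices is isolated by at least
-- a 1/(4k) fraction of all colourings, so a greedy choice of colourings removes a
-- 1/(4k) fraction of the tuples not yet isolated in every round.  There are
-- n^(k+1) < 2^((L+1)(k+1)) tuples, L = ⌊log₂ n⌋, and (1 − 1/(4k))^(4k) ≤ 1/2, so
-- 4k(L+1)(k+1) ≤ 16k²L rounds isolate all of them.

open import Defs
open import Data.Bool using (Bool; true; false; _∧_; not)
open import Data.Bool.ListAction using (all)
open import Data.Bool.Properties using (∧-comm; ∧-conicalˡ; ∧-conicalʳ)
open import Data.Empty using (⊥-elim)
open import Data.Fin as Fin using (Fin; zero; suc)
open import Data.Fin.Subset using (Subset; ∣_∣; _∉_) renaming (_∈_ to _∈ₛ_)
open import Data.Fin.Subset.Properties using (∣p∣≤∣x∷p∣)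
open import Data.List using (List; []; _∷_; _++_; map; allFin; length; cartesianProductWith)
open import Data.List.Membership.Propositional using (_∈_)
open import Data.List.Membership.Propositional.Properties
  using (∈-map⁺; ∈-map⁻; ∈-allFin; ∈-cartesianProductWith⁺)
open import Data.List.Properties using (length-map; length-tabulate; map-tabulate)
open import Data.List.Relation.Unary.Any using (here; there)
open import Data.Nat
open import Data.Nat.Logarithm using (⌊log₂_⌋; ⌊log₂⌋-mono-≤; ⌊log₂[2^n]⌋≡n)
open import Data.Nat.Properties
open import Data.Nat.Tactic.RingSolver using (solve-∀)
open import Data.Product using (Σ; ∃; _×_; _,_; proj₁; proj₂)
open import Data.Vec as Vec using (Vec; []; _∷_; lookup; tabulate; toList; padRight)
import Data.Vec.Membership.Propositional as Vec
import Data.Vec.Membership.Propositional.Properties as Vec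
open import Data.Vec.Properties using (length-toList; lookup∘tabulate; []=⇒lookup; lookup⇒[]=)
import Data.Vec.Relation.Unary.Any as VecAny
open import Relation.Binary.PropositionalEquality
open import Relation.Nullary using (Dec; does; yes; no)
open import Relation.Nullary.Decidable using (dec-false)
import Algebra.Properties.CommutativeSemigroup +-commutativeSemigroup as +-CS
import Algebra.Properties.CommutativeSemigroup *-commutativeSemigroup as *-CS

𝟙 : Bool → ℕ
𝟙 true  = 1
𝟙 false = 0

𝟙-∧ : ∀ a b → 𝟙 (a ∧ b) ≡ 𝟙 a * 𝟙 b
𝟙-∧ true  b = sym (+-identityʳ (𝟙 b))
𝟙-∧ false b = refl

𝟙-split : ∀ a b → 𝟙 a ≡ 𝟙 (a ∧ not b) + 𝟙 (a ∧ b)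
𝟙-split true  true  = refl
𝟙-split true  false = refl
𝟙-split false b     = refl

all≡true⇒ : ∀ {A : Set} (p : A → Bool) xs → all p xs ≡ true → ∀ {x} → x ∈ xs → p x ≡ true
all≡true⇒ p (x ∷ xs) all≡true (here refl) with p x
... | true = refl
all≡true⇒ p (y ∷ xs) all≡true (there x∈xs) with p y
... | true = all≡true⇒ p xs all≡true x∈xs

module _ {A : Set} where

  ∑ : List A → (A → ℕ) → ℕ
  ∑ []       f = 0
  ∑ (x ∷ xs) f = f x + ∑ xs f

  syntax ∑ xs (λ x → e) = ∑[ x ∈ xs ] e

  ∑-cong : ∀ xs {f g : A → ℕ} → (∀ x → f x ≡ g x) → ∑ xs f ≡ ∑ xs g
  ∑-cong []       f≡g = refl
  ∑-cong (x ∷ xs) f≡g = cong₂ _+_ (f≡g x) (∑-cong xs f≡g)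

  ∑-mono-≤ : ∀ xs {f g : A → ℕ} → (∀ x → f x ≤ g x) → ∑ xs f ≤ ∑ xs g
  ∑-mono-≤ []       f≤g = z≤n
  ∑-mono-≤ (x ∷ xs) f≤g = +-mono-≤ (f≤g x) (∑-mono-≤ xs f≤g)

  ∑-distrib-+ : ∀ xs (f g : A → ℕ) → ∑[ x ∈ xs ] (f x + g x) ≡ ∑ xs f + ∑ xs g
  ∑-distrib-+ []       f g = refl
  ∑-distrib-+ (x ∷ xs) f g = begin
    f x + g x + ∑[ x ∈ xs ] (f x + g x) ≡⟨ cong (f x + g x +_) (∑-distrib-+ xs f g) ⟩
    f x + g x + (∑ xs f + ∑ xs g)       ≡⟨ +-CS.interchange (f x) (g x) _ _ ⟩
    f x + ∑ xs f + (g x + ∑ xs g)       ∎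
    where open ≡-Reasoning

  ∑-distribˡ-* : ∀ xs c (f : A → ℕ) → ∑[ x ∈ xs ] (c * f x) ≡ c * ∑ xs f
  ∑-distribˡ-* []       c f = sym (*-zeroʳ c)
  ∑-distribˡ-* (x ∷ xs) c f =
    trans (cong (c * f x +_) (∑-distribˡ-* xs c f)) (sym (*-distribˡ-+ c (f x) (∑ xs f)))

  ∑-const : ∀ xs c → ∑[ x ∈ xs ] c ≡ length xs * c
  ∑-const []       c = refl
  ∑-const (x ∷ xs) c = cong (c +_) (∑-const xs c)

  ∑-++ : ∀ xs ys (f : A → ℕ) → ∑ (xs ++ ys) f ≡ ∑ xs f + ∑ ys f
  ∑-++ []       ys f = refl
  ∑-++ (x ∷ xs) ys f = trans (cong (f x +_) (∑-++ xs ys f)) (sym (+-assoc (f x) _ _))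

  ∑≡0⇒≡0 : ∀ xs (f : A → ℕ) → ∑ xs f ≡ 0 → ∀ {x} → x ∈ xs → f x ≡ 0
  ∑≡0⇒≡0 (y ∷ xs) f ∑≡0 (here refl) = m+n≡0⇒m≡0 (f y) ∑≡0
  ∑≡0⇒≡0 (y ∷ xs) f ∑≡0 (there x∈xs) = ∑≡0⇒≡0 xs f (m+n≡0⇒n≡0 (f y) ∑≡0) x∈xs

  ∑≤length*max : A → ∀ xs (f : A → ℕ) → ∃ λ x → ∑ xs f ≤ length xs * f x
  ∑≤length*max x₀ []       f = x₀ , z≤n
  ∑≤length*max x₀ (x ∷ xs) f with ∑≤length*max x₀ xs f
  ... | y , ∑≤ with f x ≤? f y
  ... | yes fx≤fy = y , +-mono-≤ fx≤fy ∑≤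
  ... | no  fx≰fy = x , +-monoʳ-≤ (f x) (≤-trans ∑≤ (*-monoʳ-≤ (length xs) (<⇒≤ (≰⇒> fx≰fy))))

∑-map : ∀ {A B : Set} (g : A → B) xs (f : B → ℕ) → ∑ (map g xs) f ≡ ∑[ x ∈ xs ] f (g x)
∑-map g []       f = refl
∑-map g (x ∷ xs) f = cong (f (g x) +_) (∑-map g xs f)

∑-comm : ∀ {A B : Set} xs ys (f : A → B → ℕ) →
         ∑[ x ∈ xs ] ∑[ y ∈ ys ] f x y ≡ ∑[ y ∈ ys ] ∑[ x ∈ xs ] f x y
∑-comm []       ys f = sym (trans (∑-const ys 0) (*-zeroʳ (length ys)))
∑-comm (x ∷ xs) ys f =
  trans (cong (∑ ys (f x) +_) (∑-comm xs ys f)) (sym (∑-distrib-+ ys (f x) _))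

∑-cartesianProductWith : ∀ {A B C : Set} (g : A → B → C) xs ys (f : C → ℕ) →
  ∑ (cartesianProductWith g xs ys) f ≡ ∑[ x ∈ xs ] ∑[ y ∈ ys ] f (g x y)
∑-cartesianProductWith g []       ys f = refl
∑-cartesianProductWith g (x ∷ xs) ys f = begin
  ∑ (map (g x) ys ++ cartesianProductWith g xs ys) f
    ≡⟨ ∑-++ (map (g x) ys) _ f ⟩
  ∑ (map (g x) ys) f + ∑ (cartesianProductWith g xs ys) f
    ≡⟨ cong₂ _+_ (∑-map (g x) ys f) (∑-cartesianProductWith g xs ys f) ⟩
  ∑[ y ∈ ys ] f (g x y) + ∑[ x ∈ xs ] ∑[ y ∈ ys ] f (g x y) ∎
  where open ≡-Reasoning

-- Counting colourings

vectors : ∀ m n → List (Vec (Fin m) n)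
vectors m zero    = [] ∷ []
vectors m (suc n) = cartesianProductWith _∷_ (allFin m) (vectors m n)

∈-vectors : ∀ {m n} (t : Vec (Fin m) n) → t ∈ vectors m n
∈-vectors []      = here refl
∈-vectors (x ∷ t) = ∈-cartesianProductWith⁺ _∷_ (∈-allFin x) (∈-vectors t)

∑-allFin-suc : ∀ m (f : Fin (suc m) → ℕ) → ∑ (allFin (suc m)) f ≡ f zero + ∑[ x ∈ allFin m ] f (suc x)
∑-allFin-suc m f = cong (f zero +_)
  (trans (cong (λ xs → ∑ xs f) (sym (map-tabulate (λ i → i) suc))) (∑-map suc (allFin m) f))

∑-allFin-const : ∀ m c → ∑[ x ∈ allFin m ] c ≡ m * c
∑-allFin-const m c = trans (∑-const (allFin m) c) (cong (_* c) (length-tabulate {n = m} (λ i → i)))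

∑-vectors-suc : ∀ m n (f : Vec (Fin m) (suc n) → ℕ) →
                ∑ (vectors m (suc n)) f ≡ ∑[ x ∈ allFin m ] ∑[ t ∈ vectors m n ] f (x ∷ t)
∑-vectors-suc m n f = ∑-cartesianProductWith _∷_ (allFin m) (vectors m n) f

∑-vectors-const : ∀ m n c → ∑[ t ∈ vectors m n ] c ≡ m ^ n * c
∑-vectors-const m zero    c = refl
∑-vectors-const m (suc n) c = begin
  ∑[ t ∈ vectors m (suc n) ] c            ≡⟨ ∑-vectors-suc m n (λ _ → c) ⟩
  ∑[ x ∈ allFin m ] ∑[ t ∈ vectors m n ] c ≡⟨ ∑-cong (allFin m) (λ _ → ∑-vectors-const m n c) ⟩
  ∑[ x ∈ allFin m ] (m ^ n * c)           ≡⟨ ∑-allFin-const m (m ^ n * c) ⟩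
  m * (m ^ n * c)                         ≡⟨ *-assoc m (m ^ n) c ⟨
  m ^ suc n * c                           ∎
  where open ≡-Reasoning

length-vectors : ∀ m n → length (vectors m n) ≡ m ^ n
length-vectors m n = *-cancelʳ-≡ _ _ 1 (trans (sym (∑-const (vectors m n) 1)) (∑-vectors-const m n 1))

isZero : ∀ {m} → Fin m → Bool
isZero zero    = true
isZero (suc _) = false

∑-isZero : ∀ m c → ∑[ x ∈ allFin (suc m) ] (𝟙 (isZero x) * c) ≡ c
∑-isZero m c = begin
  ∑[ x ∈ allFin (suc m) ] (𝟙 (isZero x) * c) ≡⟨ ∑-allFin-suc m _ ⟩
  c + 0 + ∑[ x ∈ allFin m ] 0                 ≡⟨ cong (c + 0 +_) (trans (∑-allFin-const m 0) (*-zeroʳ m)) ⟩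
  c + 0 + 0                                   ≡⟨ +-identityʳ (c + 0) ⟩
  c + 0                                       ≡⟨ +-identityʳ c ⟩
  c                                           ∎
  where open ≡-Reasoning

count-isZero-lookup : ∀ m n (j : Fin (suc n)) →
  ∑[ h ∈ vectors (suc m) (suc n) ] 𝟙 (isZero (lookup h j)) ≡ suc m ^ n
count-isZero-lookup m n zero = begin
  ∑[ h ∈ vectors (suc m) (suc n) ] 𝟙 (isZero (lookup h zero))
    ≡⟨ ∑-vectors-suc (suc m) n _ ⟩
  ∑[ x ∈ allFin (suc m) ] ∑[ t ∈ vectors (suc m) n ] 𝟙 (isZero x)
    ≡⟨ ∑-cong (allFin (suc m)) (λ x → trans (∑-vectors-const (suc m) n _) (*-comm (suc m ^ n) _)) ⟩
  ∑[ x ∈ allFin (suc m) ] (𝟙 (isZero x) * suc m ^ n)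
    ≡⟨ ∑-isZero m (suc m ^ n) ⟩
  suc m ^ n ∎
  where open ≡-Reasoning
count-isZero-lookup m (suc n) (suc j) = begin
  ∑[ h ∈ vectors (suc m) (suc (suc n)) ] 𝟙 (isZero (lookup h (suc j)))
    ≡⟨ ∑-vectors-suc (suc m) (suc n) _ ⟩
  ∑[ x ∈ allFin (suc m) ] ∑[ t ∈ vectors (suc m) (suc n) ] 𝟙 (isZero (lookup t j))
    ≡⟨ ∑-cong (allFin (suc m)) (λ _ → count-isZero-lookup m n j) ⟩
  ∑[ x ∈ allFin (suc m) ] (suc m ^ n)
    ≡⟨ ∑-allFin-const (suc m) (suc m ^ n) ⟩
  suc m ^ suc n ∎
  where open ≡-Reasoning

count-isZero-lookup₂ : ∀ m n (i j : Fin (suc (suc n))) → i ≢ j →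
  ∑[ h ∈ vectors (suc m) (suc (suc n)) ] 𝟙 (isZero (lookup h i) ∧ isZero (lookup h j)) ≡ suc m ^ n
count-isZero-lookup₂ m n zero zero i≢j = ⊥-elim (i≢j refl)
count-isZero-lookup₂ m n zero (suc j) _ = begin
  ∑[ h ∈ vectors (suc m) (suc (suc n)) ] 𝟙 (isZero (lookup h zero) ∧ isZero (lookup h (suc j)))
    ≡⟨ ∑-vectors-suc (suc m) (suc n) _ ⟩
  ∑[ x ∈ allFin (suc m) ] ∑[ t ∈ vectors (suc m) (suc n) ] 𝟙 (isZero x ∧ isZero (lookup t j))
    ≡⟨ ∑-cong (allFin (suc m)) (λ x → trans (∑-cong (vectors (suc m) (suc n)) (λ t → 𝟙-∧ (isZero x) _))
                                     (∑-distribˡ-* (vectors (suc m) (suc n)) (𝟙 (isZero x)) _)) ⟩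
  ∑[ x ∈ allFin (suc m) ] (𝟙 (isZero x) * ∑[ t ∈ vectors (suc m) (suc n) ] 𝟙 (isZero (lookup t j)))
    ≡⟨ ∑-cong (allFin (suc m)) (λ x → cong (𝟙 (isZero x) *_) (count-isZero-lookup m n j)) ⟩
  ∑[ x ∈ allFin (suc m) ] (𝟙 (isZero x) * suc m ^ n)
    ≡⟨ ∑-isZero m (suc m ^ n) ⟩
  suc m ^ n ∎
  where open ≡-Reasoning
count-isZero-lookup₂ m n (suc i) zero _ =
  trans (∑-cong (vectors (suc m) (suc (suc n))) (λ h → cong 𝟙 (∧-comm (isZero (lookup h (suc i))) _)))
        (count-isZero-lookup₂ m n zero (suc i) (λ ()))
count-isZero-lookup₂ m zero (suc zero) (suc zero) i≢j = ⊥-elim (i≢j refl)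
count-isZero-lookup₂ m (suc n) (suc i) (suc j) i≢j = begin
  ∑[ h ∈ vectors (suc m) (suc (suc (suc n))) ] 𝟙 (isZero (lookup h (suc i)) ∧ isZero (lookup h (suc j)))
    ≡⟨ ∑-vectors-suc (suc m) (suc (suc n)) _ ⟩
  ∑[ x ∈ allFin (suc m) ] ∑[ t ∈ vectors (suc m) (suc (suc n)) ] 𝟙 (isZero (lookup t i) ∧ isZero (lookup t j))
    ≡⟨ ∑-cong (allFin (suc m)) (λ _ → count-isZero-lookup₂ m n i j (λ i≡j → i≢j (cong suc i≡j))) ⟩
  ∑[ x ∈ allFin (suc m) ] (suc m ^ n)
    ≡⟨ ∑-allFin-const (suc m) (suc m ^ n) ⟩
  suc m ^ suc n ∎
  where open ≡-Reasoning

module _ {m n : ℕ} (h : Vec (Fin m) n) where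

  collides : Fin n → Fin n → Bool
  collides j f = not (does (f Fin.≟ j)) ∧ (isZero (lookup h j) ∧ isZero (lookup h f))

  isolates : ∀ {k} → Vec (Fin n) (suc k) → Bool
  isolates (j ∷ fs) = isZero (lookup h j) ∧ all (λ f → not (collides j f)) (toList fs)

  isolates⇒separated : ∀ {k} j (fs : Vec (Fin n) k) → isolates (j ∷ fs) ≡ true →
    isZero (lookup h j) ≡ true × (∀ {f} → f ∈ toList fs → f ≢ j → isZero (lookup h f) ≡ false)
  isolates⇒separated j fs isolated = j-zero , λ f∈fs f≢j →
    separated (all≡true⇒ _ (toList fs) (∧-conicalʳ _ _ isolated) f∈fs) (dec-false (_ Fin.≟ j) f≢j) j-zero
    where
      j-zero = ∧-conicalˡ _ _ isolated
      separated : ∀ {e z w} → not (not e ∧ (z ∧ w)) ≡ true → e ≡ false → z ≡ true → w ≡ false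
      separated {true}                 _  () _
      separated {false} {false}        _  _  ()
      separated {false} {true} {true}  () _  _
      separated {false} {true} {false} _  _  _ = refl

  isZero≤isolates+collisions : ∀ j (fs : List (Fin n)) →
    𝟙 (isZero (lookup h j)) ≤
      𝟙 (isZero (lookup h j) ∧ all (λ f → not (collides j f)) fs) + ∑[ f ∈ fs ] 𝟙 (collides j f)
  isZero≤isolates+collisions j []       with isZero (lookup h j)
  ... | true  = ≤-refl
  ... | false = z≤n
  isZero≤isolates+collisions j (f ∷ fs) =
    step (isZero (lookup h j)) (collides j f) (isZero≤isolates+collisions j fs)
    where
      step : ∀ z c {g b} → 𝟙 z ≤ 𝟙 (z ∧ g) + b → 𝟙 z ≤ 𝟙 (z ∧ (not c ∧ g)) + (𝟙 c + b)
      step false c      _ = z≤n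
      step true  true   _ = s≤s z≤n
      step true  false  p = p

count-collides : ∀ m n (j f : Fin (suc (suc n))) →
  ∑[ h ∈ vectors (suc m) (suc (suc n)) ] 𝟙 (collides h j f) ≤ suc m ^ n
count-collides m n j f = begin
  ∑[ h ∈ hs ] 𝟙 (collides h j f)
    ≡⟨ ∑-cong hs (λ h → 𝟙-∧ (not (does (f Fin.≟ j))) _) ⟩
  ∑[ h ∈ hs ] (𝟙 (not (does (f Fin.≟ j))) * 𝟙 (isZero (lookup h j) ∧ isZero (lookup h f)))
    ≡⟨ ∑-distribˡ-* hs (𝟙 (not (does (f Fin.≟ j)))) _ ⟩
  𝟙 (not (does (f Fin.≟ j))) * ∑[ h ∈ hs ] 𝟙 (isZero (lookup h j) ∧ isZero (lookup h f))
    ≤⟨ unless-equal (f Fin.≟ j) ⟩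
  suc m ^ n ∎
  where
    open ≤-Reasoning
    hs = vectors (suc m) (suc (suc n))
    unless-equal : (f≟j : Dec (f ≡ j)) →
      𝟙 (not (does f≟j)) * ∑[ h ∈ hs ] 𝟙 (isZero (lookup h j) ∧ isZero (lookup h f)) ≤ suc m ^ n
    unless-equal (yes _)   = z≤n
    unless-equal (no f≢j) =
      ≤-reflexive (trans (+-identityʳ _) (count-isZero-lookup₂ m n j f (λ j≡f → f≢j (sym j≡f))))

count-isolates : ∀ m n {k} (y : Vec (Fin (suc (suc n))) (suc k)) →
  suc m ^ suc n ≤ ∑[ h ∈ vectors (suc m) (suc (suc n)) ] 𝟙 (isolates h y) + k * suc m ^ n
count-isolates m n {k} (j ∷ fs) = begin
  suc m ^ suc n
    ≡⟨ count-isZero-lookup m (suc n) j ⟨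
  ∑[ h ∈ hs ] 𝟙 (isZero (lookup h j))
    ≤⟨ ∑-mono-≤ hs (λ h → isZero≤isolates+collisions h j (toList fs)) ⟩
  ∑[ h ∈ hs ] (𝟙 (isolates h (j ∷ fs)) + ∑[ f ∈ toList fs ] 𝟙 (collides h j f))
    ≡⟨ ∑-distrib-+ hs _ _ ⟩
  ∑[ h ∈ hs ] 𝟙 (isolates h (j ∷ fs)) + ∑[ h ∈ hs ] ∑[ f ∈ toList fs ] 𝟙 (collides h j f)
    ≡⟨ cong (∑[ h ∈ hs ] 𝟙 (isolates h (j ∷ fs)) +_) (∑-comm hs (toList fs) _) ⟩
  ∑[ h ∈ hs ] 𝟙 (isolates h (j ∷ fs)) + ∑[ f ∈ toList fs ] ∑[ h ∈ hs ] 𝟙 (collides h j f)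
    ≤⟨ +-monoʳ-≤ _ (∑-mono-≤ (toList fs) (count-collides m n j)) ⟩
  ∑[ h ∈ hs ] 𝟙 (isolates h (j ∷ fs)) + ∑[ f ∈ toList fs ] (suc m ^ n)
    ≡⟨ cong (∑[ h ∈ hs ] 𝟙 (isolates h (j ∷ fs)) +_)
            (trans (∑-const (toList fs) _) (cong (_* suc m ^ n) (length-toList fs))) ⟩
  ∑[ h ∈ hs ] 𝟙 (isolates h (j ∷ fs)) + k * suc m ^ n ∎
  where
    open ≤-Reasoning
    hs = vectors (suc m) (suc (suc n))

-- Greedy covering

module GreedyCover {H I : Set} (covers : H → I → Bool) (items : List I) where

  count : (I → Bool) → ℕ
  count R = ∑[ y ∈ items ] 𝟙 (R y)

  count-split : ∀ R h →
    count R ≡ count (λ y → R y ∧ not (covers h y)) + count (λ y → R y ∧ covers h y)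
  count-split R h = trans (∑-cong items (λ y → 𝟙-split (R y) (covers h y))) (∑-distrib-+ items _ _)

  heavy-hypothesis : H → ∀ hyps c a .{{_ : NonZero c}} → length hyps ≤ a * c →
    (∀ y → c ≤ ∑[ h ∈ hyps ] 𝟙 (covers h y)) →
    ∀ R → ∃ λ h → count R ≤ a * count (λ y → R y ∧ covers h y)
  heavy-hypothesis h₀ hyps c a |hyps|≤ac c≤covering R = h , *-cancelˡ-≤ c c*count≤
    where
      hits : H → ℕ
      hits h = count (λ y → R y ∧ covers h y)
      h = proj₁ (∑≤length*max h₀ hyps hits)
      c*count≤ : c * count R ≤ c * (a * hits h)
      c*count≤ = begin
        c * count R
          ≡⟨ ∑-distribˡ-* items c _ ⟨
        ∑[ y ∈ items ] (c * 𝟙 (R y))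
          ≤⟨ ∑-mono-≤ items (λ y → ≤-trans (≤-reflexive (*-comm c (𝟙 (R y))))
                                           (*-monoʳ-≤ (𝟙 (R y)) (c≤covering y))) ⟩
        ∑[ y ∈ items ] (𝟙 (R y) * ∑[ h ∈ hyps ] 𝟙 (covers h y))
          ≡⟨ ∑-cong items (λ y → sym (trans (∑-cong hyps (λ h → 𝟙-∧ (R y) (covers h y)))
                                            (∑-distribˡ-* hyps (𝟙 (R y)) _))) ⟩
        ∑[ y ∈ items ] ∑[ h ∈ hyps ] 𝟙 (R y ∧ covers h y)
          ≡⟨ ∑-comm items hyps _ ⟩
        ∑[ h ∈ hyps ] hits h
          ≤⟨ proj₂ (∑≤length*max h₀ hyps hits) ⟩
        length hyps * hits h
          ≤⟨ *-monoˡ-≤ (hits h) |hyps|≤ac ⟩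
        a * c * hits h
          ≡⟨ *-CS.xy∙z≈y∙xz a c (hits h) ⟩
        c * (a * hits h) ∎
        where open ≤-Reasoning

  uncovered : List H → I → Bool
  uncovered []       y = true
  uncovered (h ∷ hs) y = uncovered hs y ∧ not (covers h y)

  uncovered≡false⇒covered : ∀ hs y → uncovered hs y ≡ false → ∃ λ h → h ∈ hs × covers h y ≡ true
  uncovered≡false⇒covered (h ∷ hs) y unc with uncovered hs y in eq | covers h y in cov
  ... | true  | true = h , here refl , cov
  ... | false | _    =
    let h′ , h′∈hs , cov′ = uncovered≡false⇒covered hs y eq in h′ , there h′∈hs , cov′

  module _ (a′ : ℕ)
           (heavy : ∀ R → ∃ λ h → count R ≤ suc a′ * count (λ y → R y ∧ covers h y)) where

    shrink : ∀ R → ∃ λ h → suc a′ * count (λ y → R y ∧ not (covers h y)) ≤ a′ * count R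
    shrink R = h , +-cancelʳ-≤ (count R) _ _ (begin
      suc a′ * missed + count R          ≤⟨ +-monoʳ-≤ (suc a′ * missed) (proj₂ (heavy R)) ⟩
      suc a′ * missed + suc a′ * hit     ≡⟨ *-distribˡ-+ (suc a′) missed hit ⟨
      suc a′ * (missed + hit)            ≡⟨ cong (suc a′ *_) (count-split R h) ⟨
      suc a′ * count R                   ≡⟨ +-comm (count R) (a′ * count R) ⟩
      a′ * count R + count R             ∎)
      where
        open ≤-Reasoning
        h = proj₁ (heavy R)
        missed = count (λ y → R y ∧ not (covers h y))
        hit    = count (λ y → R y ∧ covers h y)

    greedy : ∀ t → ∃ λ hs → length hs ≡ t × suc a′ ^ t * count (uncovered hs) ≤ a′ ^ t * length items
    greedy zero = [] , refl , *-monoʳ-≤ 1 (≤-reflexive (trans (∑-const items 1) (*-identityʳ _)))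
    greedy (suc t) with greedy t
    ... | hs , refl , bound with shrink (uncovered hs)
    ... | h , shrunk = h ∷ hs , refl , (begin
      suc a′ ^ suc t * count (uncovered (h ∷ hs))   ≡⟨ *-CS.xy∙z≈y∙xz (suc a′) (suc a′ ^ t) _ ⟩
      suc a′ ^ t * (suc a′ * count (uncovered (h ∷ hs)))
                                                    ≤⟨ *-monoʳ-≤ (suc a′ ^ t) shrunk ⟩
      suc a′ ^ t * (a′ * count (uncovered hs))      ≡⟨ *-CS.x∙yz≈y∙xz (suc a′ ^ t) a′ _ ⟩
      a′ * (suc a′ ^ t * count (uncovered hs))      ≤⟨ *-monoʳ-≤ a′ bound ⟩
      a′ * (a′ ^ t * length items)                  ≡⟨ *-assoc a′ (a′ ^ t) (length items) ⟨
      a′ ^ suc t * length items                     ∎)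
      where open ≤-Reasoning

    greedy-cover : ∀ t → a′ ^ t * length items < suc a′ ^ t →
      ∃ λ hs → length hs ≡ t × ∀ {y} → y ∈ items → ∃ λ h → h ∈ hs × covers h y ≡ true
    greedy-cover t small with greedy t
    ... | hs , |hs|≡t , bound = hs , |hs|≡t , λ {y} y∈items →
      uncovered≡false⇒covered hs y (𝟙≡0⇒false (∑≡0⇒≡0 items _ none-uncovered y∈items))
      where
        none-uncovered : count (uncovered hs) ≡ 0
        none-uncovered = n<1⇒n≡0 (*-cancelˡ-< (suc a′ ^ t) (count (uncovered hs)) 1
          (≤-trans (s≤s bound) (≤-trans small (≤-reflexive (sym (*-identityʳ _))))))
        𝟙≡0⇒false : ∀ {b} → 𝟙 b ≡ 0 → b ≡ false
        𝟙≡0⇒false {false} _ = refl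

^-distribʳ-* : ∀ m n o → (m * n) ^ o ≡ m ^ o * n ^ o
^-distribʳ-* m n zero    = refl
^-distribʳ-* m n (suc o) =
  trans (cong (m * n *_) (^-distribʳ-* m n o)) (*-CS.interchange m n (m ^ o) (n ^ o))

bernoulli : ∀ x t → x ^ suc t + suc t * x ^ t ≤ suc x ^ suc t
bernoulli x zero    = ≤-reflexive (+-comm (x * 1) 1)
bernoulli x (suc t) = begin
  x ^ suc (suc t) + suc (suc t) * x ^ suc t
    ≤⟨ m≤m+n _ (suc t * x ^ t) ⟩
  x ^ suc (suc t) + suc (suc t) * x ^ suc t + suc t * x ^ t
    ≡⟨ expand x t (x ^ t) ⟩
  suc x * (x ^ suc t + suc t * x ^ t)
    ≤⟨ *-monoʳ-≤ (suc x) (bernoulli x t) ⟩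
  suc x ^ suc (suc t) ∎
  where
    open ≤-Reasoning
    expand : ∀ x t X → x * (x * X) + suc (suc t) * (x * X) + suc t * X ≡ suc x * (x * X + suc t * X)
    expand = solve-∀

-- (1 − 1/a)^a ≤ 1/2 for a = n + 1
2*n^[1+n]≤[1+n]^[1+n] : ∀ n → 2 * n ^ suc n ≤ suc n ^ suc n
2*n^[1+n]≤[1+n]^[1+n] n = begin
  2 * n ^ suc n              ≡⟨ cong (n ^ suc n +_) (+-identityʳ _) ⟩
  n ^ suc n + n * n ^ n      ≤⟨ +-monoʳ-≤ (n ^ suc n) (*-monoˡ-≤ (n ^ n) (n≤1+n n)) ⟩
  n ^ suc n + suc n * n ^ n  ≤⟨ bernoulli n n ⟩
  suc n ^ suc n              ∎
  where open ≤-Reasoning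

n^[[1+n]B]*x<[1+n]^[[1+n]B] : ∀ n B x .{{_ : NonZero n}} → x < 2 ^ B →
                              n ^ (suc n * B) * x < suc n ^ (suc n * B)
n^[[1+n]B]*x<[1+n]^[[1+n]B] n B x x<2^B = begin-strict
  n ^ (a * B) * x       <⟨ *-monoʳ-< (n ^ (a * B)) {{m^n≢0 n (a * B)}} x<2^B ⟩
  n ^ (a * B) * 2 ^ B   ≡⟨ cong (_* 2 ^ B) (^-*-assoc n a B) ⟨
  (n ^ a) ^ B * 2 ^ B   ≡⟨ *-comm ((n ^ a) ^ B) (2 ^ B) ⟩
  2 ^ B * (n ^ a) ^ B   ≡⟨ ^-distribʳ-* 2 (n ^ a) B ⟨
  (2 * n ^ a) ^ B       ≤⟨ ^-monoˡ-≤ B (2*n^[1+n]≤[1+n]^[1+n] n) ⟩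
  (a ^ a) ^ B           ≡⟨ ^-*-assoc a a B ⟩
  a ^ (a * B)           ∎
  where
    open ≤-Reasoning
    a = suc n

n<2^[1+⌊log₂n⌋] : ∀ n → n < 2 ^ suc ⌊log₂ n ⌋
n<2^[1+⌊log₂n⌋] n with 2 ^ suc ⌊log₂ n ⌋ ≤? n
... | no  2^[1+L]≰n = ≰⇒> 2^[1+L]≰n
... | yes 2^[1+L]≤n = ⊥-elim (1+n≰n (≤-trans (≤-reflexive (sym (⌊log₂[2^n]⌋≡n (suc ⌊log₂ n ⌋))))
                                              (⌊log₂⌋-mono-≤ 2^[1+L]≤n)))

rounds≤ : ∀ k L → 1 ≤ k → 1 ≤ L → 4 * k * (suc L * suc k) ≤ 16 * k ^ 2 * L
rounds≤ k L 1≤k 1≤L = begin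
  4 * k * (suc L * suc k)       ≤⟨ *-monoʳ-≤ (4 * k) (*-mono-≤ (suc≤2* 1≤L) (suc≤2* 1≤k)) ⟩
  4 * k * ((L + L) * (k + k))   ≡⟨ collect k L ⟩
  16 * k ^ 2 * L                ∎
  where
    open ≤-Reasoning
    suc≤2* : ∀ {n} → 1 ≤ n → suc n ≤ n + n
    suc≤2* {n} 1≤n = +-monoˡ-≤ n 1≤n
    collect : ∀ k l → 4 * k * ((l + l) * (k + k)) ≡ 16 * (k * (k * 1)) * l
    collect = solve-∀

often-isolated : ∀ k′ n′ (y : Vec (Fin (suc (suc n′))) (suc (suc k′))) →
  suc k′ * (2 * suc k′) ^ n′ ≤ ∑[ h ∈ vectors (2 * suc k′) (suc (suc n′)) ] 𝟙 (isolates h y)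
often-isolated k′ n′ y = +-cancelʳ-≤ (k * M ^ n′) _ _ (begin
  k * M ^ n′ + k * M ^ n′  ≡⟨ double k (M ^ n′) ⟩
  M * M ^ n′               ≤⟨ count-isolates _ n′ y ⟩
  ∑[ h ∈ vectors M (suc (suc n′)) ] 𝟙 (isolates h y) + k * M ^ n′ ∎)
  where
    open ≤-Reasoning
    k = suc k′
    M = 2 * k
    double : ∀ k X → k * X + k * X ≡ 2 * k * X
    double = solve-∀

isolating-colourings : ∀ k n → 1 ≤ k → 2 ≤ n →
  ∃ λ (hs : List (Vec (Fin (2 * k)) n)) → length hs ≤ 16 * k ^ 2 * ⌊log₂ n ⌋ ×
    ∀ (y : Vec (Fin n) (suc k)) → ∃ λ h → h ∈ hs × isolates h y ≡ true
isolating-colourings zero           _                ()    _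
isolating-colourings (suc _)        (suc zero)       _     (s≤s ())
isolating-colourings k@(suc k′) n@(suc (suc n′)) 1≤k 2≤n =
  let hs , |hs|≡T , covered = greedy-cover a′ heavy T few-items
  in  hs , ≤-trans (≤-reflexive |hs|≡T) (rounds≤ k L 1≤k (⌊log₂⌋-mono-≤ 2≤n)) ,
      λ y → covered (∈-vectors y)
  where
    open GreedyCover (λ h → isolates h {k}) (vectors n (suc k))
    L = ⌊log₂ n ⌋
    M = 2 * k
    a′ = pred (4 * k)
    B = suc L * suc k
    T = 4 * k * B
    c = k * M ^ n′

    -- pred (4 * k) normalises to k′ + suc _
    instance
      a′-nonZero : NonZero a′
      a′-nonZero = >-nonZero (≤-trans (s≤s z≤n) (m≤n+m _ k′))

    |colourings| : length (vectors M n) ≡ 4 * k * c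
    |colourings| = trans (length-vectors M n) (regroup k (M ^ n′))
      where
        regroup : ∀ k X → 2 * k * (2 * k * X) ≡ 4 * k * (k * X)
        regroup = solve-∀

    heavy : ∀ R → ∃ λ h → count R ≤ 4 * k * count (λ y → R y ∧ isolates h y)
    heavy = heavy-hypothesis (Vec.replicate n zero) (vectors M n) c (4 * k)
              {{m*n≢0 k (M ^ n′) {{_}} {{m^n≢0 M n′}}}}
              (≤-reflexive |colourings|) (often-isolated k′ n′)

    few-items : a′ ^ T * length (vectors n (suc k)) < (4 * k) ^ T
    few-items = subst (λ x → a′ ^ T * x < (4 * k) ^ T) (sym (length-vectors n (suc k)))
      (n^[[1+n]B]*x<[1+n]^[[1+n]B] a′ B (n ^ suc k)
        (<-≤-trans (^-monoˡ-< (suc k) (n<2^[1+⌊log₂n⌋] n)) (≤-reflexive (^-*-assoc 2 (suc L) (suc k)))))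

-- Rectangles from colourings

elements : ∀ {n} (p : Subset n) → Vec (Fin n) ∣ p ∣
elements []          = []
elements (true ∷ p)  = zero ∷ Vec.map suc (elements p)
elements (false ∷ p) = Vec.map suc (elements p)

∈-elements : ∀ {n} {p : Subset n} {x} → x ∈ₛ p → x Vec.∈ elements p
∈-elements {p = true ∷ p}  Vec.here         = VecAny.here refl
∈-elements {p = true ∷ p}  (Vec.there x∈p) = VecAny.there (Vec.∈-map⁺ suc (∈-elements x∈p))
∈-elements {p = false ∷ p} (Vec.there x∈p) = Vec.∈-map⁺ suc (∈-elements x∈p)

x∈p⇒0<∣p∣ : ∀ {n} {p : Subset n} {x} → x ∈ₛ p → 0 < ∣ p ∣
x∈p⇒0<∣p∣ Vec.here                       = s≤s z≤n
x∈p⇒0<∣p∣ {p = b ∷ p} (Vec.there x∈p) = <-≤-trans (x∈p⇒0<∣p∣ x∈p) (∣p∣≤∣x∷p∣ b p)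

∈-padRight⁺ : ∀ {A : Set} {m n} (m≤n : m ≤ n) (a : A) {xs : Vec A m} {x} →
              x Vec.∈ xs → x Vec.∈ padRight m≤n a xs
∈-padRight⁺ (s≤s m≤n) a (VecAny.here x≡y)    = VecAny.here x≡y
∈-padRight⁺ (s≤s m≤n) a (VecAny.there x∈xs) = VecAny.there (∈-padRight⁺ m≤n a x∈xs)

zeros : ∀ {m n} → Vec (Fin m) n → Subset n
zeros h = tabulate (λ x → isZero (lookup h x))

∈-zeros⁺ : ∀ {m n} (h : Vec (Fin m) n) {x} → isZero (lookup h x) ≡ true → x ∈ₛ zeros h
∈-zeros⁺ h {x} x-zero = lookup⇒[]= x (zeros h) (trans (lookup∘tabulate _ x) x-zero)

∈-zeros⁻ : ∀ {m n} (h : Vec (Fin m) n) {x} → x ∈ₛ zeros h → isZero (lookup h x) ≡ true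
∈-zeros⁻ h {x} x∈zeros = trans (sym (lookup∘tabulate _ x)) ([]=⇒lookup x∈zeros)

module _ (𝕂 : OrderedField) where
  open Geometry 𝕂

  0<∣facet∣ : ∀ {d n} (v : Fin n → Point d) {F} → IsFacet v F → 0 < ∣ F ∣
  0<∣facet∣ v F-facet = x∈p⇒0<∣p∣ (proj₂ (proj₁ (proj₂ (proj₁ F-facet))))

  zeroRectangle : ∀ {m n} → Vec (Fin m) n → Rectangle n
  zeroRectangle h = (λ F → ∀ x → x ∈ₛ zeros h → x ∉ F) ×ᴿ zeros h

  isolating⇒covering : ∀ {d n m k} (v : Fin n → Point d) (hs : List (Vec (Fin m) n)) →
    (∀ F → IsFacet v F → ∣ F ∣ ≤ k) →
    (∀ (y : Vec (Fin n) (suc k)) → ∃ λ h → h ∈ hs × isolates h y ≡ true) →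
    IsRectangleCovering v (map zeroRectangle hs)
  isolating⇒covering v hs small isolating = in-support , covered
    where
      in-support : ∀ {R} → R ∈ map zeroRectangle hs → InSupport v R
      in-support R∈ with ∈-map⁻ zeroRectangle R∈
      ... | h , _ , refl = λ F _ avoids-zeros → avoids-zeros

      covered : ∀ F → IsFacet v F → ∀ j → j ∉ F →
        ∃ λ R → R ∈ map zeroRectangle hs × Rectangle.rows R F × j ∈ₛ Rectangle.cols R
      covered F F-facet j j∉F =
        zeroRectangle h , ∈-map⁺ zeroRectangle h∈hs , avoids-zeros , ∈-zeros⁺ h (proj₁ separated)
        where
          -- the padding entries equal j, which never collides with itself
          fs = padRight (small F F-facet) j (elements F)
          h = proj₁ (isolating (j ∷ fs))
          h∈hs = proj₁ (proj₂ (isolating (j ∷ fs)))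
          separated = isolates⇒separated h j fs (proj₂ (proj₂ (isolating (j ∷ fs))))
          avoids-zeros : ∀ x → x ∈ₛ zeros h → x ∉ F
          avoids-zeros x x-zero x∈F
            with trans (sym (∈-zeros⁻ h x-zero)) (proj₂ separated
                   (Vec.∈-toList⁺ (∈-padRight⁺ (small F F-facet) j (∈-elements x∈F)))
                   (λ x≡j → j∉F (subst (_∈ₛ F) x≡j x∈F)))
          ... | ()

proposition3p2 : ∃ λ (C : ℕ) →
    (K : OrderedField) → let open Geometry K in
    (d n k : ℕ) → (v : Fin n → Point d) →
    ConvexPosition v →
    2 ≤ n →
    (∀ F → IsFacet v F → ∣ F ∣ ≤ k) →
    Σ (List (Rectangle n)) λ Rs →
      IsRectangleCovering v Rs × length Rs ≤ C * (k ^ 2) * ⌊log₂ n ⌋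
proposition3p2 = 16 , λ where
  𝕂 d n zero v _ _ small →
    [] , ((λ ()) , λ F F-facet _ _ → ⊥-elim (<⇒≱ (0<∣facet∣ 𝕂 v F-facet) (small F F-facet))) , z≤n
  𝕂 d n k@(suc _) v _ 2≤n small →
    let hs , |hs|≤ , isolating = isolating-colourings k n (s≤s z≤n) 2≤n
    in  map (zeroRectangle 𝕂) hs , isolating⇒covering 𝕂 v hs small isolating ,
        subst (_≤ 16 * (k ^ 2) * ⌊log₂ n ⌋) (sym (length-map (zeroRectangle 𝕂) hs)) |hs|≤
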